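{- Let $X\in\mathrm{Def}(\mathcal{S})$ be such that $(n+1)X\leq nX$ for some positive integer $n$. Then $2X\leq_0 X$.
   Context: $\mathcal{S}=(S;\dots)$ is a first-order structure; "definable" means definable with parameters; $\mathrm{Def}(\mathcal{S})$ is the collection of definable subsets of the powers $S^n$. A fixed collection of isomorphisms $\mathcal{I}_n$ of definable bijections $S^n\to S^n$, closed under composition and inverses, is given. For definable $X,Y$: $X\leq Y$ means there is a finite definable partition $\{X_i\}$ of $X$ and isomorphisms $f_i$ with the $f_i(X_i)$ pairwise disjoint and $\bigcup_i f_i(X_i)\subseteq Y$. $nX$ denotes the disjoint union of $n$ copies of $X$. For $m>0$, $X\leq_m Y$ means there are positive integers $p,q$ with $m\leq p/q$ and $pX\leq qY$. $X\leq_0 Y$ means for every $m>0$ there is a definable $X_0\subseteq X$ with $X_0\leq_m X$ and $(X\setminus X_0)\leq Y$. -}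

module Defs where

open import Data.Nat using (ℕ; zero; suc; _+_; _*_; _<_)
open import Data.Fin using (Fin; remainder)
open import Data.Vec using (Vec; []; _∷_; _∷ʳ_; _++_; lookup; tail; init)
open import Data.Product using (Σ; Σ-syntax; _×_; _,_)
open import Data.Sum using (_⊎_)
open import Data.Integer using (+_)
open import Data.Rational as ℚ using (ℚ; 0ℚ)
open import Relation.Nullary using (¬_)
open import Data.Empty using (⊥)
open import Relation.Binary.PropositionalEquality using (_≡_)
open import Function using (_∘_)

Sub : Set → ℕ → Set₁
Sub S k = Vec S k → Set

-- The setting: a first-order structure on S, presented through its
-- collection of definable (with parameters) subsets of the powers S^k,
-- axiomatised as a "structure on S" in the sense of van den Dries
-- (Boolean algebras, closed under products with S, containing diagonals,
-- closed under coordinate projections, containing singletons = parameters);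
-- plus the fixed collections I_k of definable bijections S^k → S^k,
-- closed under composition and inverses.
record Setting : Set₁ where
  field
    S   : Set
    Def : (k : ℕ) → Sub S k → Set
    -- definability does not depend on the presentation of the predicate
    Def-ext   : ∀ {k} {A B : Sub S k} → (∀ x → (A x → B x) × (B x → A x)) → Def k A → Def k B
    Def-empty : ∀ k → Def k (λ _ → ⊥)
    Def-compl : ∀ {k} {A : Sub S k} → Def k A → Def k (λ x → ¬ A x)
    Def-union : ∀ {k} {A B : Sub S k} → Def k A → Def k B → Def k (λ x → A x ⊎ B x)
    Def-inter : ∀ {k} {A B : Sub S k} → Def k A → Def k B → Def k (λ x → A x × B x)
    Def-prodˡ : ∀ {k} {A : Sub S k} → Def k A → Def (suc k) (λ x → A (tail x))
    Def-prodʳ : ∀ {k} {A : Sub S k} → Def k A → Def (suc k) (λ x → A (init x))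
    Def-diag  : ∀ {k} (i j : Fin k) → Def k (λ x → lookup x i ≡ lookup x j)
    Def-projˡ : ∀ {k} {A : Sub S (suc k)} → Def (suc k) A → Def k (λ x → Σ S (λ s → A (s ∷ x)))
    Def-projʳ : ∀ {k} {A : Sub S (suc k)} → Def (suc k) A → Def k (λ x → Σ S (λ s → A (x ∷ʳ s)))
    Def-point : (s : S) → Def 1 (λ x → x ≡ s ∷ [])
    Iso       : (k : ℕ) → (Vec S k → Vec S k) → Set
    Iso-def   : ∀ {k} {f : Vec S k → Vec S k} → Iso k f →
                Def (k + k) (λ w → Σ (Vec S k) (λ x → w ≡ x ++ f x))
    Iso-inv   : ∀ {k} {f : Vec S k → Vec S k} → Iso k f →
                Σ (Vec S k → Vec S k) (λ g → Iso k g × (∀ x → g (f x) ≡ x) × (∀ y → f (g y) ≡ y))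
    Iso-comp  : ∀ {k} {f g : Vec S k → Vec S k} → Iso k f → Iso k g → Iso k (f ∘ g)

module _ (𝒮 : Setting) where
  open Setting 𝒮

  -- A finite formal disjoint union of subsets of S^k: copies indexed by Fin size.
  record FSet (k : ℕ) : Set₁ where
    constructor fset
    field
      size : ℕ
      part : Fin size → Sub S k
  open FSet public

  single : ∀ {k} → Sub S k → FSet k
  single A = fset 1 (λ _ → A)

  DefF : ∀ {k} → FSet k → Set
  DefF X = ∀ c → Def _ (part X c)

  _·_ : ∀ {k} → ℕ → FSet k → FSet k
  n · X = fset (n * size X) (λ i → part X (remainder {n} (size X) i))

  SubF : ∀ {k} (X₀ X : FSet k) → size X₀ ≡ size X → Set
  SubF X₀ X _≡_.refl = ∀ c x → part X₀ c x → part X c x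

  DiffF : ∀ {k} (X X₀ : FSet k) → size X₀ ≡ size X → FSet k
  DiffF X X₀ _≡_.refl = fset (size X) (λ c x → part X c x × ¬ part X₀ c x)

  -- X ≤ Y: a finite definable partition {X_i} of X (each piece lives in one copy of X)
  -- and isomorphisms f_i sending X_i into a copy of Y, with pairwise disjoint images.
  Le : ∀ {k} → FSet k → FSet k → Set₁
  Le {k} X Y =
    Σ ℕ λ m →
    Σ (Fin m → Fin (size X)) λ src →
    Σ (Fin m → Sub S k) λ P →
    Σ (Fin m → Fin (size Y)) λ tgt →
    Σ (Fin m → Vec S k → Vec S k) λ f →
      (∀ i → Def k (P i))
    × (∀ i → Iso k (f i))
    × (∀ i x → P i x → part X (src i) x)
    × (∀ c x → part X c x → Σ (Fin m) λ i → src i ≡ c × P i x)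
    × (∀ i j x → src i ≡ src j → P i x → P j x → i ≡ j)
    × (∀ i x → P i x → part Y (tgt i) (f i x))
    × (∀ i j x y → tgt i ≡ tgt j → P i x → P j y → f i x ≡ f j y → i ≡ j)

  LeM : ∀ {k} → ℚ → FSet k → FSet k → Set₁
  LeM m X Y =
    Σ ℕ λ p → Σ ℕ λ q′ →
      0 < p × (m ℚ.≤ ((+ p) ℚ./ suc q′)) × Le (p · X) (suc q′ · Y)

  Le0 : ∀ {k} → FSet k → FSet k → Set₁
  Le0 X Y =
    ∀ (m : ℚ) → 0ℚ ℚ.< m →
      Σ (FSet _) λ X₀ → Σ (size X₀ ≡ size X) λ e →
        DefF X₀ × SubF X₀ X e × LeM m X₀ X × Le (DiffF X X₀ e) Y

-- Iterating (n+1)X ≤ nX, each time adding one copy of X to both sides (X ≤ X through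
-- the identity, or trivially when X is empty), gives pX ≤ nX for every p > n. Let
-- X₀ ⊆ 2X be the second copy of X. Then pX₀ is pX up to relabelling copies, and nX sits
-- in n(2X) as the first copies, so pX₀ ≤ n(2X) with p/n as large as we like; and
-- 2X ∖ X₀ is the first copy of X, which is ≤ X.
module Submission where

open import Data.Empty using (⊥; ⊥-elim)
open import Data.Fin as Fin using (Fin; zero; suc; combine; remQuot)
open import Data.Fin.Properties
  using (*↔×; +↔⊎; 0↔⊥; ¬Fin0; suc-injective; remQuot-combine; combine-remQuot; combine-injectiveˡ)
open import Data.Integer as ℤ using (+_; -[1+_]; ∣_∣)
import Data.Integer.Properties as ℤ
open import Data.Nat using (ℕ; zero; suc; _+_; _*_; _<_; z≤n; s≤s)
open import Data.Nat.Properties using (+-identityʳ; +-suc; +-comm; *-identityʳ; ≤-trans; m≤m+n; m≤m*n; m≤n+m)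
open import Data.Product using (Σ; _×_; _,_; proj₁; proj₂)
open import Data.Rational as ℚ using (ℚ; mkℚ)
open import Data.Rational.Properties using (toℚᵘ-cancel-≤; toℚᵘ-fromℚᵘ)
open import Data.Rational.Unnormalised using (mkℚᵘ; *≤*)
import Data.Rational.Unnormalised.Properties as ℚᵘ
open import Data.Sum using (_⊎_; inj₁; inj₂; [_,_])
open import Data.Vec using (Vec; []; _∷_; _++_; take; init; cast)
open import Data.Vec.Properties using (cast-is-id; ++-injective)
open import Function using (_∘_; id)
open import Function.Bundles using (Inverse; _↔_)
open import Function.Definitions using (Injective)
open import Function.Properties.Inverse using (↔-refl)
open import Relation.Binary.PropositionalEquality using (_≡_; _≗_; refl; sym; trans; cong; subst; subst₂)
open import Relation.Nullary using (¬_; yes; no)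

open import Defs

module _ {a} {A : Set a} where

  cast≡take : ∀ k (w : Vec A (k + 0)) .(e : k + 0 ≡ k) → cast e w ≡ take k w
  cast≡take zero    []      e = refl
  cast≡take (suc k) (x ∷ w) e = cong (x ∷_) (cast≡take k w _)

  take-init-cast : ∀ k {j} (w : Vec A (k + suc j)) .(e : k + suc j ≡ suc (k + j)) →
                   take k (init (cast e w)) ≡ take k w
  take-init-cast zero    w       e = refl
  take-init-cast (suc k) (x ∷ w) e = cong (x ∷_) (take-init-cast k w _)

  take-++ : ∀ {k j} (y : Vec A k) (x : Vec A j) → take k (y ++ x) ≡ y
  take-++ []      x = refl
  take-++ (s ∷ y) x = cong (s ∷_) (take-++ y x)

module Definability (𝒮 : Setting) where
  open Setting 𝒮

  Def-≗ : ∀ {j k} {A : Sub S j} {f g : Vec S k → Vec S j} → f ≗ g → Def k (A ∘ f) → Def k (A ∘ g)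
  Def-≗ {A = A} f≗g = Def-ext (λ x → subst A (f≗g x) , subst A (sym (f≗g x)))

  Def-cast : ∀ {j k} (e : j ≡ k) {A : Sub S j} → Def j A → Def k (A ∘ cast (sym e))
  Def-cast refl {A} = Def-≗ {A = A} (λ w → sym (cast-is-id refl w))

  Def-take : ∀ {k} j {A : Sub S k} → Def k A → Def (k + j) (A ∘ take k)
  Def-take {k} zero {A} dA =
    Def-≗ {A = A} (λ w → cast≡take k w _) (Def-cast (sym (+-identityʳ k)) dA)
  Def-take {k} (suc j) {A} dA =
    Def-≗ {A = A} (λ w → take-init-cast k w _)
      (Def-cast (sym (+-suc k j)) (Def-prodʳ (Def-take j dA)))

  Def-∃-prefix : ∀ j {k} {B : Sub S (j + k)} → Def (j + k) B →
                 Def k (λ x → Σ (Vec S j) λ y → B (y ++ x))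
  Def-∃-prefix zero    dB = Def-ext (λ x → (λ b → [] , b) , λ { ([] , b) → b }) dB
  Def-∃-prefix (suc j) dB =
    Def-ext (λ x → (λ { (y , s , b) → s ∷ y , b }) , λ { (s ∷ y , b) → y , s , b })
            (Def-∃-prefix j (Def-projˡ dB))

  -- {x ∣ Q (f x)} is the projection of {y ++ x ∣ Q y}, cut down to the graph of f⁻¹.
  Def-preimage : ∀ {k} {Q : Sub S k} {f : Vec S k → Vec S k} → Iso k f → Def k Q → Def k (Q ∘ f)
  Def-preimage {k} {Q} {f} iso dQ with Iso-inv iso
  ... | g , iso-g , gf≗id , fg≗id =
    Def-ext (λ x → from-graph x , to-graph x)
            (Def-∃-prefix k (Def-inter (Iso-def iso-g) (Def-take k dQ)))
    where
      Graph-g : Sub S (k + k)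
      Graph-g w = Σ (Vec S k) λ y → w ≡ y ++ g y

      from-graph : ∀ x → (Σ (Vec S k) λ y → Graph-g (y ++ x) × Q (take k (y ++ x))) → Q (f x)
      from-graph x (y , (y′ , eq) , q) with refl , refl ← ++-injective y y′ eq =
        subst Q (trans (take-++ y x) (sym (fg≗id y))) q

      to-graph : ∀ x → Q (f x) → Σ (Vec S k) λ y → Graph-g (y ++ x) × Q (take k (y ++ x))
      to-graph x q = f x , (f x , cong (f x ++_) (sym (gf≗id x))) , subst Q (sym (take-++ (f x) x)) q

module Embeddings (𝒮 : Setting) where
  open Setting 𝒮
  open Definability 𝒮

  IdentityIso : ℕ → Set
  IdentityIso k = Σ (Vec S k → Vec S k) λ e → Iso k e × (∀ x → e x ≡ x)

  Iso-identity : ∀ {k f} → Iso k f → IdentityIso k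
  Iso-identity {f = f} iso with Iso-inv iso
  ... | g , iso-g , gf≗id , _ = g ∘ f , Iso-comp iso-g iso , gf≗id

  Iso-injective : ∀ {k f} → Iso k f → Injective _≡_ _≡_ f
  Iso-injective iso {x} {y} eq with Iso-inv iso
  ... | g , _ , gf≗id , _ = trans (sym (gf≗id x)) (trans (cong g eq) (gf≗id y))

  Empty : ∀ {k} → FSet 𝒮 k → Set
  Empty A = ∀ c x → ¬ part A c x

  -- The data of Le A B, with the pieces indexed by an arbitrary type so that composites
  -- and sums can be indexed by I × J and I ⊎ J before being renumbered by Fin.
  record PiecewiseEmbedding {k} (A B : FSet 𝒮 k) (I : Set) : Set₁ where
    field
      src            : I → Fin (size A)
      piece          : I → Sub S k
      tgt            : I → Fin (size B)
      map            : I → Vec S k → Vec S k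
      piece-def      : ∀ i → Def k (piece i)
      map-iso        : ∀ i → Iso k (map i)
      piece-⊆        : ∀ i x → piece i x → part A (src i) x
      cover          : ∀ c x → part A c x → Σ I λ i → src i ≡ c × piece i x
      disjoint       : ∀ i j x → src i ≡ src j → piece i x → piece j x → i ≡ j
      image-⊆        : ∀ i x → piece i x → part B (tgt i) (map i x)
      image-disjoint : ∀ i j x y → tgt i ≡ tgt j → piece i x → piece j y → map i x ≡ map j y → i ≡ j

  module _ {k} {A B : FSet 𝒮 k} where

    Le⇒embedding : (le : Le 𝒮 A B) → PiecewiseEmbedding A B (Fin (proj₁ le))
    Le⇒embedding (_ , src , piece , tgt , map , piece-def , map-iso , piece-⊆ , cover , disjoint ,
                  image-⊆ , image-disjoint) = record
      { src = src ; piece = piece ; tgt = tgt ; map = map ; piece-def = piece-def ; map-iso = map-iso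
      ; piece-⊆ = piece-⊆ ; cover = cover ; disjoint = disjoint
      ; image-⊆ = image-⊆ ; image-disjoint = image-disjoint
      }

    embedding⇒Le : ∀ {m I} → Fin m ↔ I → PiecewiseEmbedding A B I → Le 𝒮 A B
    embedding⇒Le {m} Fin↔I E =
      m , src ∘ to , piece ∘ to , tgt ∘ to , map ∘ to , piece-def ∘ to , map-iso ∘ to ,
      piece-⊆ ∘ to , cover′ , (λ r r′ x e p q → to-injective (disjoint _ _ x e p q)) ,
      image-⊆ ∘ to , (λ r r′ x y e p q eq → to-injective (image-disjoint _ _ x y e p q eq))
      where
        open PiecewiseEmbedding E
        open Inverse Fin↔I using (to; from; strictlyInverseˡ; strictlyInverseʳ)

        to-injective : ∀ {r r′} → to r ≡ to r′ → r ≡ r′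
        to-injective {r} {r′} eq =
          trans (sym (strictlyInverseʳ r)) (trans (cong from eq) (strictlyInverseʳ r′))

        cover′ : ∀ c x → part A c x → Σ (Fin m) λ r → src (to r) ≡ c × piece (to r) x
        cover′ c x a with cover c x a
        ... | i , src-i≡c , p =
          from i , subst (λ i′ → src i′ ≡ c × piece i′ x) (sym (strictlyInverseˡ i)) (src-i≡c , p)

  compose : ∀ {k} {A B C : FSet 𝒮 k} {I J} →
            PiecewiseEmbedding A B I → PiecewiseEmbedding B C J → PiecewiseEmbedding A C (I × J)
  compose {k} {A} {B} {C} {I} {J} E F = record
    { src            = E.src ∘ proj₁
    ; piece          = piece
    ; tgt            = F.tgt ∘ proj₂
    ; map            = λ (i , j) → F.map j ∘ E.map i
    ; piece-def      = piece-def
    ; map-iso        = λ (i , j) → Iso-comp (F.map-iso j) (E.map-iso i)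
    ; piece-⊆        = λ (i , j) x (p , _ , _) → E.piece-⊆ i x p
    ; cover          = cover
    ; disjoint       = disjoint
    ; image-⊆        = λ (i , j) x (p , _ , q) → F.image-⊆ j (E.map i x) q
    ; image-disjoint = image-disjoint
    }
    where
      module E = PiecewiseEmbedding E
      module F = PiecewiseEmbedding F

      piece : I × J → Sub S k
      piece (i , j) x = E.piece i x × E.tgt i ≡ F.src j × F.piece j (E.map i x)

      piece-def : ∀ ij → Def k (piece ij)
      piece-def (i , j) with E.tgt i Fin.≟ F.src j
      ... | yes e = Def-ext (λ x → (λ (p , q) → p , e , q) , (λ (p , _ , q) → p , q))
                            (Def-inter (E.piece-def i) (Def-preimage (E.map-iso i) (F.piece-def j)))
      ... | no ¬e = Def-ext (λ x → (λ ()) , (λ (_ , e , _) → ¬e e)) (Def-empty k)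

      cover : ∀ c x → part A c x → Σ (I × J) λ (i , j) → E.src i ≡ c × piece (i , j) x
      cover c x a with E.cover c x a
      ... | i , src-i≡c , p with F.cover (E.tgt i) (E.map i x) (E.image-⊆ i x p)
      ... | j , src-j≡tgt-i , q = (i , j) , src-i≡c , p , sym src-j≡tgt-i , q

      disjoint : ∀ a b x → E.src (proj₁ a) ≡ E.src (proj₁ b) → piece a x → piece b x → a ≡ b
      disjoint (i , j) (i′ , j′) x e (p , e₁ , q) (p′ , e₁′ , q′)
        with refl ← E.disjoint i i′ x e p p′
        with refl ← F.disjoint j j′ (E.map i x) (trans (sym e₁) e₁′) q q′ = refl

      image-disjoint : ∀ a b x y → F.tgt (proj₂ a) ≡ F.tgt (proj₂ b) → piece a x → piece b y →
                       F.map (proj₂ a) (E.map (proj₁ a) x) ≡ F.map (proj₂ b) (E.map (proj₁ b) y) → a ≡ b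
      image-disjoint (i , j) (i′ , j′) x y e (p , e₁ , q) (p′ , e₁′ , q′) eq
        with refl ← F.image-disjoint j j′ _ _ e q q′ eq
        with refl ← E.image-disjoint i i′ x y (trans e₁ (sym e₁′)) p p′ (Iso-injective (F.map-iso j) eq) = refl

  Le-trans : ∀ {k} {A B C : FSet 𝒮 k} → Le 𝒮 A B → Le 𝒮 B C → Le 𝒮 A C
  Le-trans {A = A} {B} {C} A≤B B≤C =
    embedding⇒Le *↔× (compose (Le⇒embedding {A = A} {B} A≤B) (Le⇒embedding {A = B} {C} B≤C))

  Le-empty : ∀ {k} {A B : FSet 𝒮 k} → Empty A → Le 𝒮 A B
  Le-empty {A = A} {B} empty = embedding⇒Le {A = A} {B} 0↔⊥ record
    { src = λ () ; piece = λ () ; tgt = λ () ; map = λ () ; piece-def = λ () ; map-iso = λ ()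
    ; piece-⊆ = λ () ; cover = λ c x a → ⊥-elim (empty c x a) ; disjoint = λ ()
    ; image-⊆ = λ () ; image-disjoint = λ () }

  Le-refl : ∀ {k} {A : FSet 𝒮 k} → IdentityIso k → DefF 𝒮 A → Le 𝒮 A A
  Le-refl {A = A} (e , iso-e , e≗id) dA = embedding⇒Le {A = A} {A} ↔-refl record
    { src = id ; piece = part A ; tgt = id ; map = λ _ → e ; piece-def = dA ; map-iso = λ _ → iso-e
    ; piece-⊆ = λ _ _ a → a ; cover = λ c _ a → c , refl , a ; disjoint = λ _ _ _ e _ _ → e
    ; image-⊆ = λ c x a → subst (part A c) (sym (e≗id x)) a ; image-disjoint = λ _ _ _ _ e _ _ _ → e }

  -- The identity need not lie in Iso k, but it does as soon as Iso k is inhabited, and a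
  -- comparison without pieces can only start from an empty set.
  identity-or-empty : ∀ {k} {A B : FSet 𝒮 k} → Le 𝒮 A B → IdentityIso k ⊎ Empty A
  identity-or-empty (zero  , _ , _ , _ , _ , _ , _ , _ , cover , _) = inj₂ (λ c x a → ¬Fin0 (proj₁ (cover c x a)))
  identity-or-empty (suc _ , _ , _ , _ , _ , _ , map-iso , _) = inj₁ (Iso-identity (map-iso zero))

  Le-reindexˡ : ∀ {k} {A A′ B : FSet 𝒮 k} (σ : Fin (size A) → Fin (size A′)) → Injective _≡_ _≡_ σ →
                (∀ c x → part A c x → part A′ (σ c) x) →
                (∀ c′ x → part A′ c′ x → Σ (Fin (size A)) λ c → σ c ≡ c′ × part A c x) →
                Le 𝒮 A B → Le 𝒮 A′ B
  Le-reindexˡ {A = A} {A′} {B} σ σ-injective A⊆A′ A′⊆A A≤B = embedding⇒Le {A = A′} {B} ↔-refl record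
    { src      = σ ∘ E.src
    ; piece-⊆  = λ i x p → A⊆A′ (E.src i) x (E.piece-⊆ i x p)
    ; cover    = cover
    ; disjoint = λ i j x e → E.disjoint i j x (σ-injective e)
    ; E hiding (src; piece-⊆; cover; disjoint)
    }
    where
      module E = PiecewiseEmbedding (Le⇒embedding {A = A} {B} A≤B)

      cover : ∀ c′ x → part A′ c′ x → Σ _ λ i → σ (E.src i) ≡ c′ × E.piece i x
      cover c′ x a′ with A′⊆A c′ x a′
      ... | c , σc≡c′ , a with E.cover c x a
      ... | i , src-i≡c , p = i , trans (cong σ src-i≡c) σc≡c′ , p

  Le-reindexʳ : ∀ {k} {A B B′ : FSet 𝒮 k} (τ : Fin (size B) → Fin (size B′)) → Injective _≡_ _≡_ τ →
                (∀ c x → part B c x → part B′ (τ c) x) → Le 𝒮 A B → Le 𝒮 A B′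
  Le-reindexʳ {A = A} {B} {B′} τ τ-injective B⊆B′ A≤B = embedding⇒Le {A = A} {B′} ↔-refl record
    { tgt            = τ ∘ E.tgt
    ; image-⊆        = λ i x p → B⊆B′ (E.tgt i) (E.map i x) (E.image-⊆ i x p)
    ; image-disjoint = λ i j x y e → E.image-disjoint i j x y (τ-injective e)
    ; E hiding (tgt; image-⊆; image-disjoint)
    }
    where
      module E = PiecewiseEmbedding (Le⇒embedding {A = A} {B} A≤B)

module Copies (𝒮 : Setting) where
  open Setting 𝒮
  open Embeddings 𝒮

  copies : ∀ {k} → ℕ → Sub S k → FSet 𝒮 k
  copies c A = fset c (λ _ → A)

  Le-suc : ∀ {k a b} {A B : Sub S k} →
           Le 𝒮 (copies 1 A) (copies 1 B) → Le 𝒮 (copies a A) (copies b B) →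
           Le 𝒮 (copies (suc a) A) (copies (suc b) B)
  Le-suc {k} {a} {b} {A} {B} A≤B As≤Bs =
    embedding⇒Le {A = copies (suc a) A} {copies (suc b) B} +↔⊎ record
    { src            = src
    ; piece          = piece
    ; tgt            = tgt
    ; map            = map
    ; piece-def      = λ { (inj₁ i) → E.piece-def i ; (inj₂ j) → F.piece-def j }
    ; map-iso        = λ { (inj₁ i) → E.map-iso i ; (inj₂ j) → F.map-iso j }
    ; piece-⊆        = λ { (inj₁ i) → E.piece-⊆ i ; (inj₂ j) → F.piece-⊆ j }
    ; cover          = cover
    ; disjoint       = disjoint
    ; image-⊆        = λ { (inj₁ i) → E.image-⊆ i ; (inj₂ j) → F.image-⊆ j }
    ; image-disjoint = image-disjoint
    }
    where
      module E = PiecewiseEmbedding (Le⇒embedding {A = copies 1 A} {copies 1 B} A≤B)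
      module F = PiecewiseEmbedding (Le⇒embedding {A = copies a A} {copies b B} As≤Bs)

      Pieces = Fin (proj₁ A≤B) ⊎ Fin (proj₁ As≤Bs)

      src : Pieces → Fin (suc a)
      src (inj₁ _) = zero
      src (inj₂ j) = suc (F.src j)

      tgt : Pieces → Fin (suc b)
      tgt (inj₁ _) = zero
      tgt (inj₂ j) = suc (F.tgt j)

      piece : Pieces → Sub S k
      piece = [ E.piece , F.piece ]

      map : Pieces → Vec S k → Vec S k
      map = [ E.map , F.map ]

      Fin1-unique : ∀ (c c′ : Fin 1) → c ≡ c′
      Fin1-unique zero zero = refl

      cover : ∀ c x → A x → Σ Pieces λ i → src i ≡ c × piece i x
      cover zero x a with E.cover zero x a
      ... | i , _ , p = inj₁ i , refl , p
      cover (suc c) x a with F.cover c x a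
      ... | j , src-j≡c , q = inj₂ j , cong suc src-j≡c , q

      disjoint : ∀ i j x → src i ≡ src j → piece i x → piece j x → i ≡ j
      disjoint (inj₁ i) (inj₁ i′) x _ p p′ = cong inj₁ (E.disjoint i i′ x (Fin1-unique _ _) p p′)
      disjoint (inj₂ j) (inj₂ j′) x e q q′ = cong inj₂ (F.disjoint j j′ x (suc-injective e) q q′)
      disjoint (inj₁ _) (inj₂ _) _ () _ _
      disjoint (inj₂ _) (inj₁ _) _ () _ _

      image-disjoint : ∀ i j x y → tgt i ≡ tgt j → piece i x → piece j y → map i x ≡ map j y → i ≡ j
      image-disjoint (inj₁ i) (inj₁ i′) x y _ p p′ eq =
        cong inj₁ (E.image-disjoint i i′ x y (Fin1-unique _ _) p p′ eq)
      image-disjoint (inj₂ j) (inj₂ j′) x y e q q′ eq =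
        cong inj₂ (F.image-disjoint j j′ x y (suc-injective e) q q′ eq)
      image-disjoint (inj₁ _) (inj₂ _) _ _ () _ _ _
      image-disjoint (inj₂ _) (inj₁ _) _ _ () _ _ _

  copies-refl : ∀ {k a c} {A : Sub S k} {B : FSet 𝒮 k} → Def k A → Le 𝒮 (copies (suc a) A) B →
                Le 𝒮 (copies c A) (copies c A)
  copies-refl {a = a} {c} {A} {B} dA A≤B with identity-or-empty {A = copies (suc a) A} {B} A≤B
  ... | inj₁ identity = Le-refl {A = copies c A} identity (λ _ → dA)
  ... | inj₂ empty    = Le-empty {A = copies c A} {copies c A} (λ _ x → empty zero x)

  copies-absorb : ∀ {k n} {A : Sub S k} → Def k A → Le 𝒮 (copies (suc n) A) (copies n A) →
                  ∀ j → Le 𝒮 (copies (j + suc n) A) (copies n A)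
  copies-absorb dA n+1≤n zero    = n+1≤n
  copies-absorb {n = n} {A} dA n+1≤n (suc j) =
    Le-trans {A = copies (suc j + suc n) A} {copies (suc n) A} {copies n A}
      (Le-suc {B = A} (copies-refl {B = copies n A} dA n+1≤n) (copies-absorb dA n+1≤n j)) n+1≤n

  module _ {k} {A : Sub S k} {Y : FSet 𝒮 k} (r : Fin (size Y)) (A⊆Y : ∀ x → A x → part Y r x) where

    private
      embed : ∀ {p} → Fin p → Fin (p * size Y)
      embed {p} c = combine {p} c r

      embed-injective : ∀ {p} → Injective _≡_ _≡_ (embed {p})
      embed-injective {x = c} {c′} = combine-injectiveˡ c r c′ r

      A⊆pY : ∀ {p} c x → A x → part (_·_ 𝒮 p Y) (embed c) x
      A⊆pY {p} c x a =
        subst (λ r′ → part Y r′ x) (sym (cong proj₂ (remQuot-combine {p} {size Y} c r))) (A⊆Y x a)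

    Le-multipleˡ : ∀ {p} {B : FSet 𝒮 k} → (∀ c x → part Y c x → c ≡ r × A x) →
                   Le 𝒮 (copies p A) B → Le 𝒮 (_·_ 𝒮 p Y) B
    Le-multipleˡ {p} {B} Y⊆A =
      Le-reindexˡ {A = copies p A} {_·_ 𝒮 p Y} {B} embed (embed-injective {p}) (A⊆pY {p}) pY⊆A
      where
        pY⊆A : ∀ c′ x → part (_·_ 𝒮 p Y) c′ x → Σ (Fin p) λ c → embed c ≡ c′ × A x
        pY⊆A c′ x y with Y⊆A _ x y
        ... | remainder≡r , a = quotient , embed-quotient≡c′ , a
          where
            quotient = proj₁ (remQuot {p} (size Y) c′)
            embed-quotient≡c′ : embed quotient ≡ c′
            embed-quotient≡c′ =
              trans (cong (combine quotient) (sym remainder≡r)) (combine-remQuot {p} (size Y) c′)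

    Le-multipleʳ : ∀ {q} {B : FSet 𝒮 k} → Le 𝒮 B (copies q A) → Le 𝒮 B (_·_ 𝒮 q Y)
    Le-multipleʳ {q} {B} =
      Le-reindexʳ {A = B} {copies q A} {_·_ 𝒮 q Y} embed (embed-injective {q}) (A⊆pY {q})

  copies-·-single : ∀ {k} c (A : Sub S k) → _·_ 𝒮 c (single 𝒮 A) ≡ copies c A
  copies-·-single c A = cong (λ s → fset s (λ _ → A)) (*-identityʳ c)

  module _ {k} (A : Sub S k) where

    secondCopy : FSet 𝒮 k
    secondCopy = fset 2 λ { zero → λ _ → ⊥ ; (suc zero) → A }

    secondCopy-def : Def k A → DefF 𝒮 secondCopy
    secondCopy-def _  zero       = Def-empty k
    secondCopy-def dA (suc zero) = dA

    secondCopy-⊆ : SubF 𝒮 secondCopy (copies 2 A) refl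
    secondCopy-⊆ (suc zero) x a = a

    Le-secondCopy : ∀ {p n} → Le 𝒮 (copies p A) (copies n A) →
                    Le 𝒮 (_·_ 𝒮 p secondCopy) (_·_ 𝒮 n (copies 2 A))
    Le-secondCopy {n = n} le =
      Le-multipleˡ {A = A} {secondCopy} (suc zero) (λ _ a → a) {B = _·_ 𝒮 n (copies 2 A)}
        (λ { (suc zero) _ a → refl , a })
        (Le-multipleʳ {A = A} {copies 2 A} zero (λ _ a → a) le)

    Le-firstCopy : Le 𝒮 (copies 1 A) (copies 1 A) →
                   Le 𝒮 (DiffF 𝒮 (copies 2 A) secondCopy refl) (copies 1 A)
    Le-firstCopy = Le-reindexˡ {A = copies 1 A} {DiffF 𝒮 (copies 2 A) secondCopy refl} {copies 1 A}
      (λ _ → zero) (λ { {zero} {zero} _ → refl }) (λ _ _ a → a , λ ())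
      (λ { zero _ (a , _) → zero , refl , a ; (suc zero) _ (a , ¬a) → ⊥-elim (¬a a) })

-- _/_ normalises, so the comparison is made on its unnormalised representative.
archimedean : ∀ (m : ℚ) c d → Σ ℕ λ j → m ℚ.≤ + (j + c) ℚ./ suc d
archimedean (mkℚ i d₀ _) c d =
  j , toℚᵘ-cancel-≤ (ℚᵘ.≤-respʳ-≃ (ℚᵘ.≃-sym (toℚᵘ-fromℚᵘ (mkℚᵘ (+ (j + c)) d))) (*≤* cross))
  where
    open ℤ.≤-Reasoning
    j = ∣ i ∣ * suc d

    ≤-abs : ∀ i → i ℤ.* + suc d ℤ.≤ + (∣ i ∣ * suc d)
    ≤-abs (+ a)    = ℤ.≤-reflexive (sym (ℤ.pos-* a (suc d)))
    ≤-abs -[1+ a ] = ℤ.-≤+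

    cross : i ℤ.* + suc d ℤ.≤ + (j + c) ℤ.* + suc d₀
    cross = begin
      i ℤ.* + suc d           ≤⟨ ≤-abs i ⟩
      + j                     ≤⟨ ℤ.+≤+ (≤-trans (m≤m+n j c) (m≤m*n (j + c) (suc d₀))) ⟩
      + ((j + c) * suc d₀)    ≡⟨ ℤ.pos-* (j + c) (suc d₀) ⟩
      + (j + c) ℤ.* + suc d₀  ∎

corollary6p1 : (𝒮 : Setting) → let open Setting 𝒮 in
    ∀ {k} (X : Vec S k → Set) → Def k X →
    (n : ℕ) → 0 < n →
    Le 𝒮 (_·_ 𝒮 (n + 1) (single 𝒮 X)) (_·_ 𝒮 n (single 𝒮 X)) →
    Le0 𝒮 (_·_ 𝒮 2 (single 𝒮 X)) (single 𝒮 X)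
corollary6p1 𝒮 X dX zero ()
corollary6p1 𝒮 X dX n@(suc q) _ n+1≤n m _ =
  let j , m≤p/n = archimedean m (suc n) q
      p = j + suc n
  in secondCopy X , refl , secondCopy-def X dX , secondCopy-⊆ X ,
     (p , q , ≤-trans (s≤s z≤n) (m≤n+m (suc n) j) , m≤p/n , Le-secondCopy X (copies-absorb dX n+1≤n′ j)) ,
     Le-firstCopy X (copies-refl {B = copies n X} dX n+1≤n′)
  where
    open Copies 𝒮

    n+1≤n′ : Le 𝒮 (copies (suc n) X) (copies n X)
    n+1≤n′ = subst₂ (Le 𝒮) (trans (copies-·-single (n + 1) X) (cong (λ c → copies c X) (+-comm n 1)))
                           (copies-·-single n X) n+1≤n
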